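{- Let $\lambda$ be an MAT-labeling of a finite simple graph $G$ and let $F_1,F_2\subseteq E_G$. If $\lambda|_{F_1}$ is an MAT-labeling of $(V_G,F_1)$ and $\lambda|_{F_2}$ is an MAT-labeling of $(V_G,F_2)$, then $\lambda|_{F_1\cup F_2}$ is an MAT-labeling of $(V_G,F_1\cup F_2)$.
   Context: For a finite simple graph $G$ and map $\lambda:E_G\to\mathbb{Z}_{>0}$, put $\pi_k=\lambda^{ -1}(k)$, $E_k=\pi_1\sqcup\dots\sqcup\pi_k$, $E_0=\varnothing$. For $F\subseteq E_G$, $\operatorname{cl}(F)$ is the set of edges whose two endvertices are joined by a path of edges in $F$. $\lambda$ is an MAT-labeling if for every $k\in\mathbb{Z}_{>0}$: (ML1) $\pi_k$ is a forest; (ML2) $\operatorname{cl}(\pi_k)\cap E_{k-1}=\varnothing$; (ML3) every edge $\{u,v\}\in\pi_k$ forms exactly $k-1$ triangles with edges in $E_{k-1}$ (exactly $k-1$ vertices $w$ with $\{u,w\},\{v,w\}\in E_{k-1}$). -}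

module Defs where

open import Data.Nat using (ℕ; zero; suc; _≤ᵇ_; _∸_)
open import Data.Bool using (Bool; true; false; _∧_; _∨_; T)
open import Data.Fin using (Fin; zero; suc; inject₁; fromℕ)
open import Data.List using (List; length; filterᵇ; allFin)
open import Data.Product using (_×_)
open import Relation.Binary.PropositionalEquality using (_≡_)
open import Relation.Nullary using (¬_)
open import Relation.Binary.Construct.Closure.ReflexiveTransitive using (Star)
open import Function.Definitions using (Injective)

-- An edge set on the vertex set Fin n, encoded as a Bool-valued
-- relation; {u,v} is an edge iff E u v ≡ true (E is required symmetric).
EdgeSet : ℕ → Set
EdgeSet n = Fin n → Fin n → Bool

record SimpleGraph (n : ℕ) : Set where
  field
    edge      : EdgeSet n
    edge-sym  : ∀ u v → edge u v ≡ edge v u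
    edge-irr  : ∀ u → edge u u ≡ false

open SimpleGraph public

_⊆ₑ_ : ∀ {n} → EdgeSet n → EdgeSet n → Set
F ⊆ₑ E = ∀ u v → T (F u v) → T (E u v)

_∪ₑ_ : ∀ {n} → EdgeSet n → EdgeSet n → EdgeSet n
(F ∪ₑ F') u v = F u v ∨ F' u v

-- A labeling of the edges: a symmetric function on vertex pairs,
-- whose values on pairs that are not edges are irrelevant.
Labeling : ℕ → Set
Labeling n = Fin n → Fin n → ℕ

π : ∀ {n} → EdgeSet n → Labeling n → ℕ → EdgeSet n
π E λ' k u v = E u v ∧ (λ' u v ≤ᵇ k) ∧ (k ≤ᵇ λ' u v)

Eₖ : ∀ {n} → EdgeSet n → Labeling n → ℕ → EdgeSet n
Eₖ E λ' k u v = E u v ∧ (1 ≤ᵇ λ' u v) ∧ (λ' u v ≤ᵇ k)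

record Cycle {n : ℕ} (F : EdgeSet n) : Set where
  field
    m     : ℕ
    vtx   : Fin (suc (suc (suc m))) → Fin n
    inj   : Injective _≡_ _≡_ vtx
    step  : ∀ (i : Fin (suc (suc m))) → T (F (vtx (inject₁ i)) (vtx (suc i)))
    close : T (F (vtx (fromℕ (suc (suc m)))) (vtx zero))

IsForest : ∀ {n} → EdgeSet n → Set
IsForest F = ¬ Cycle F

Path : ∀ {n} → EdgeSet n → Fin n → Fin n → Set
Path F = Star (λ u v → T (F u v))

commonNbrs : ∀ {n} → EdgeSet n → Fin n → Fin n → ℕ
commonNbrs {n} S u v = length (filterᵇ (λ w → S u w ∧ S v w) (allFin n))

-- λ is an MAT-labeling of the graph (Fin n, E):
-- labels are positive on edges, symmetric, and for every k > 0
-- (ML1), (ML2), (ML3) hold.  cl(π_k) ∩ E_{k-1} = ∅ is stated as: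
-- no edge of E_{k-1} has its endpoints joined by a path in π_k.
record IsMATLabeling {n : ℕ} (E : EdgeSet n) (λ' : Labeling n) : Set where
  field
    positive : ∀ u v → T (E u v) → T (1 ≤ᵇ λ' u v)
    symmetric : ∀ u v → T (E u v) → λ' u v ≡ λ' v u
    ML1 : ∀ k → T (1 ≤ᵇ k) → IsForest (π E λ' k)
    ML2 : ∀ k → T (1 ≤ᵇ k) → ∀ u v → T (Eₖ E λ' (k ∸ 1) u v) → ¬ Path (π E λ' k) u v
    ML3 : ∀ k → T (1 ≤ᵇ k) → ∀ u v → T (π E λ' k u v) →
          commonNbrs (Eₖ E λ' (k ∸ 1)) u v ≡ k ∸ 1

-- The conditions (ML1) and (ML2) only forbid configurations (cycles in π_k, paths in π_k
-- between endpoints of lighter edges), so they pass to every subset of the edge set of an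
-- MAT-labeled graph; so does the upper bound in (ML3), as triangle counts grow with the edge
-- set. Hence for F ⊆ E_G only the lower bound k - 1 in (ML3) must be checked. For an edge of
-- F₁ ∪ F₂ lying in F_i it is supplied by the MAT-labeling of F_i, whose triangles are among
-- those of F₁ ∪ F₂.
module Submission where

open import Defs
open import Relation.Binary.PropositionalEquality using (_≡_; refl; sym)
open import Data.Fin using (Fin)
open import Data.Nat using (ℕ; _≤_; _≤ᵇ_; _∸_)
open import Data.Nat.Properties using (≤-antisym; ≤-reflexive; ≤-trans; module ≤-Reasoning)
open import Data.Bool using (Bool; true; false; _∧_; _∨_; T)
open import Data.Bool.Properties using (T-∧; T-∨; T?)
import Data.Product
open import Data.Sum using (_⊎_; inj₁; inj₂; [_,_])
open import Data.List using (allFin)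
open import Data.List.Relation.Binary.Sublist.Propositional using (⊆-refl)
open import Data.List.Relation.Binary.Sublist.Propositional.Properties using (filter⁺; length-mono-≤)
open import Function using (id; _∘_; Equivalence)
open import Relation.Binary.Construct.Closure.ReflexiveTransitive using (gmap)

open Equivalence using (to; from)

private
  variable
    n : ℕ
    E F F₁ F₂ : EdgeSet n
    λ' : Labeling n

∪ₑ-upperˡ : ∀ (F₁ F₂ : EdgeSet n) → F₁ ⊆ₑ (F₁ ∪ₑ F₂)
∪ₑ-upperˡ F₁ F₂ u v e = from T-∨ (inj₁ e)

∪ₑ-upperʳ : ∀ (F₁ F₂ : EdgeSet n) → F₂ ⊆ₑ (F₁ ∪ₑ F₂)
∪ₑ-upperʳ F₁ F₂ u v e = from T-∨ (inj₂ e)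

∪ₑ-least : F₁ ⊆ₑ E → F₂ ⊆ₑ E → (F₁ ∪ₑ F₂) ⊆ₑ E
∪ₑ-least s₁ s₂ u v e = [ s₁ u v , s₂ u v ] (to T-∨ e)

T-∧-map : ∀ {a b c d} → (T a → T b) → (T c → T d) → T (a ∧ c) → T (b ∧ d)
T-∧-map {a} {b} {c} {d} f g = from (T-∧ {b} {d}) ∘ Data.Product.map f g ∘ to (T-∧ {a} {c})

T-∨-∧-split : ∀ a b c → T ((a ∨ b) ∧ c) → T (a ∧ c) ⊎ T (b ∧ c)
T-∨-∧-split true  b     c e = inj₁ e
T-∨-∧-split false true  c e = inj₂ e

π-mono : ∀ λ' k → F ⊆ₑ E → π F λ' k ⊆ₑ π E λ' k
π-mono λ' k s u v = T-∧-map (s u v) id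

Eₖ-mono : ∀ λ' k → F ⊆ₑ E → Eₖ F λ' k ⊆ₑ Eₖ E λ' k
Eₖ-mono λ' k s u v = T-∧-map (s u v) id

π-∪ : ∀ (F₁ F₂ : EdgeSet n) λ' k u v →
      T (π (F₁ ∪ₑ F₂) λ' k u v) → T (π F₁ λ' k u v) ⊎ T (π F₂ λ' k u v)
π-∪ F₁ F₂ λ' k u v = T-∨-∧-split (F₁ u v) (F₂ u v) ((λ' u v ≤ᵇ k) ∧ (k ≤ᵇ λ' u v))

IsForest-anti : F ⊆ₑ E → IsForest E → IsForest F
IsForest-anti s acyclic c = acyclic (record
  { m = m ; vtx = vtx ; inj = inj ; step = λ i → s _ _ (step i) ; close = s _ _ close })
  where open Cycle c

Path-mono : F ⊆ₑ E → ∀ {u v} → Path F u v → Path E u v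
Path-mono s = gmap id (s _ _)

commonNbrs-mono : F ⊆ₑ E → ∀ u v → commonNbrs F u v ≤ commonNbrs E u v
commonNbrs-mono {n} {F} {E} s u v =
  length-mono-≤ (filter⁺ (T? ∘ common F) (T? ∘ common E) (λ { refl → common-mono })
                          (⊆-refl {x = allFin n}))
  where
  common : EdgeSet n → Fin n → Bool
  common S w = S u w ∧ S v w
  common-mono : ∀ {w} → T (common F w) → T (common E w)
  common-mono {w} = T-∧-map (s u w) (s v w)

EnoughTriangles : EdgeSet n → Labeling n → Set
EnoughTriangles F λ' = ∀ k → T (1 ≤ᵇ k) → ∀ u v → T (π F λ' k u v) →
  k ∸ 1 ≤ commonNbrs (Eₖ F λ' (k ∸ 1)) u v

IsMATLabeling⇒EnoughTriangles : IsMATLabeling F λ' → EnoughTriangles F λ'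
IsMATLabeling⇒EnoughTriangles M k k≥1 u v e =
  ≤-reflexive (sym (IsMATLabeling.ML3 M k k≥1 u v e))

EnoughTriangles-∪ : EnoughTriangles F₁ λ' → EnoughTriangles F₂ λ' → EnoughTriangles (F₁ ∪ₑ F₂) λ'
EnoughTriangles-∪ {F₁ = F₁} {λ'} {F₂} T₁ T₂ k k≥1 u v e with π-∪ F₁ F₂ λ' k u v e
... | inj₁ e₁ = ≤-trans (T₁ k k≥1 u v e₁)
                      (commonNbrs-mono (Eₖ-mono λ' (k ∸ 1) (∪ₑ-upperˡ F₁ F₂)) u v)
... | inj₂ e₂ = ≤-trans (T₂ k k≥1 u v e₂)
                      (commonNbrs-mono (Eₖ-mono λ' (k ∸ 1) (∪ₑ-upperʳ F₁ F₂)) u v)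

IsMATLabeling-⊆ : F ⊆ₑ E → IsMATLabeling E λ' → EnoughTriangles F λ' → IsMATLabeling F λ'
IsMATLabeling-⊆ {F = F} {E} {λ'} s M enough = record
  { positive  = λ u v f → positive u v (s u v f)
  ; symmetric = λ u v f → symmetric u v (s u v f)
  ; ML1 = λ k k≥1 → IsForest-anti (π-mono λ' k s) (ML1 k k≥1)
  ; ML2 = λ k k≥1 u v f → ML2 k k≥1 u v (Eₖ-mono λ' (k ∸ 1) s u v f) ∘ Path-mono (π-mono λ' k s)
  ; ML3 = λ k k≥1 u v f → ≤-antisym
      (begin
        commonNbrs (Eₖ F λ' (k ∸ 1)) u v ≤⟨ commonNbrs-mono (Eₖ-mono λ' (k ∸ 1) s) u v ⟩
        commonNbrs (Eₖ E λ' (k ∸ 1)) u v ≡⟨ ML3 k k≥1 u v (π-mono λ' k s u v f) ⟩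
        k ∸ 1                            ∎)
      (enough k k≥1 u v f)
  }
  where
  open IsMATLabeling M
  open ≤-Reasoning

lemma4p7 : ∀ {n} (G : SimpleGraph n) (λ' : Labeling n) (F₁ F₂ : EdgeSet n) →
    IsMATLabeling (edge G) λ' →
    (∀ u v → F₁ u v ≡ F₁ v u) → F₁ ⊆ₑ edge G →
    (∀ u v → F₂ u v ≡ F₂ v u) → F₂ ⊆ₑ edge G →
    IsMATLabeling F₁ λ' → IsMATLabeling F₂ λ' →
    IsMATLabeling (F₁ ∪ₑ F₂) λ'
lemma4p7 G λ' F₁ F₂ M _ F₁⊆G _ F₂⊆G M₁ M₂ =
  IsMATLabeling-⊆ {F = F₁ ∪ₑ F₂} (∪ₑ-least F₁⊆G F₂⊆G) M
    (EnoughTriangles-∪ {F₁ = F₁} {F₂ = F₂}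
      (IsMATLabeling⇒EnoughTriangles M₁) (IsMATLabeling⇒EnoughTriangles M₂))
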